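{- Let $\lambda$ be a quadrated partition. Then $\lambda$ is a $\mathcal P$-position of LCTR. Further, if $\lambda$ is nonempty, then $L(T(\lambda))=T(L(\lambda))$, and if this partition is not of the form $(n)$ or $(1^n)$, then it is also a $\mathcal P$-position. Hence $\lambda$ and such $L(T(\lambda))$ have Sprague-Grundy value $0$.
   Context: A partition is quadrated if all of its parts are even and each part occurs an even number of times (the empty partition is quadrated). $(1^n)$ denotes $n$ parts equal to $1$. LCTR: positions are partitions; from nonempty $\lambda=(\lambda_1,\dots,\lambda_k)$ one may move to $T(\lambda)=(\lambda_2,\dots,\lambda_k)$ or $L(\lambda)=(\lambda_1-1,\dots,\lambda_k-1)$ (nonpositive entries omitted); $()$ has no moves; normal play. A $\mathcal P$-position is one from which the previous player (the one who just moved) has a winning strategy. $\mathrm{SG}(())=0$, $\mathrm{SG}(\lambda)=\mathrm{mex}\{\mathrm{SG}(L(\lambda)),\mathrm{SG}(T(\lambda))\}$ otherwise, with $\mathrm{mex}(B)$ the least nonnegative integer not in $B$. -}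

module Defs where

open import Data.Nat using (ℕ; zero; suc; _≥_; _<_; _≟_)
open import Data.Nat.Divisibility using (_∣_)
open import Data.List using (List; []; _∷_; length; filter; replicate)
open import Data.List.Relation.Unary.All using (All)
open import Data.List.Relation.Unary.Linked using (Linked)
open import Data.Product using (∃; _×_)
open import Data.Sum using (_⊎_)
open import Relation.Binary.PropositionalEquality using (_≡_; _≢_)

IsPartition : List ℕ → Set
IsPartition xs = All (0 <_) xs × Linked _≥_ xs

Even : ℕ → Set
Even n = 2 ∣ n

count : ℕ → List ℕ → ℕ
count x xs = length (filter (x ≟_) xs)

Quadrated : List ℕ → Set
Quadrated xs = All Even xs × (∀ x → Even (count x xs))

-- T: remove the largest (first) part; T () = () (never used as a move)
Tm : List ℕ → List ℕ
Tm []       = []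
Tm (_ ∷ xs) = xs

Lm : List ℕ → List ℕ
Lm []                  = []
Lm (zero ∷ xs)         = Lm xs
Lm (suc zero ∷ xs)     = Lm xs
Lm (suc (suc n) ∷ xs)  = suc n ∷ Lm xs

-- Outcome classes of LCTR (normal play), defined inductively.
-- IsP λ : previous player wins; IsN λ : next player wins.
data IsP : List ℕ → Set
data IsN : List ℕ → Set

data IsP where
  P-empty : IsP []
  P-cons  : ∀ {x xs} → IsN (Lm (x ∷ xs)) → IsN (Tm (x ∷ xs)) → IsP (x ∷ xs)

data IsN where
  N-L : ∀ {x xs} → IsP (Lm (x ∷ xs)) → IsN (x ∷ xs)
  N-T : ∀ {x xs} → IsP (Tm (x ∷ xs)) → IsN (x ∷ xs)

-- mex of the two-element set {a , b}
mex2 : ℕ → ℕ → ℕ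
mex2 (suc _) (suc _) = 0
mex2 zero (suc zero) = 2
mex2 (suc zero) zero = 2
mex2 _ _ = 1

-- Sprague–Grundy value, as a (functional) inductive relation:
-- SG λ g  means  SG(λ) = g.
data SG : List ℕ → ℕ → Set where
  SG-empty : SG [] 0
  SG-cons  : ∀ {x xs a b} → SG (Lm (x ∷ xs)) a → SG (Tm (x ∷ xs)) b →
             SG (x ∷ xs) (mex2 a b)

IsSingle : List ℕ → Set
IsSingle μ = ∃ λ n → μ ≡ n ∷ []

IsOnes : List ℕ → Set
IsOnes μ = ∃ λ n → μ ≡ replicate n 1

-- A quadrated partition is the quadrate of a partition μ: every part m of μ
-- becomes two parts 2m. Two L moves turn the quadrate of μ into the quadrate
-- of L μ, and two T moves into the quadrate of T μ, so the second player wins by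
-- copying the first player's move. From L (T λ), which is 2m − 1 followed by
-- L (quadrate (T μ)), the second player answers T with L and L with T, reaching
-- L (L (quadrate (T μ))); this answer exists unless L (T λ) is (2m − 1) or
-- consists of ones only.
module Submission where

open import Defs
open import Data.Nat using (ℕ; zero; suc; _+_; _*_; _≤_; _<_; _≥_; z≤n; s≤s; _≟_)
open import Data.Nat.Properties
  using (≤-refl; ≤-trans; ≤-pred; ≤-<-trans; <-irrefl; ≤∧≢⇒<; m≤m+n; m≤n+m; *-cancelʳ-≤)
open import Data.Nat.Divisibility using (divides; ∣1⇒≡1; ∣m+n∣m⇒∣n; ∣-refl)
open import Data.List using (List; []; _∷_; length)
open import Data.List.Properties using (filter-accept; filter-reject; filter-none)
open import Data.List.Relation.Unary.All as All using (All; []; _∷_)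
open import Data.List.Relation.Unary.Linked as Linked using (Linked; []; [-]; _∷_)
open import Data.List.Relation.Unary.Linked.Properties using (Linked⇒All)
open import Data.Product using (∃; _×_; _,_; proj₁; proj₂)
open import Data.Empty using (⊥-elim)
open import Function using (_∘_)
open import Relation.Nullary using (¬_; yes; no)
open import Relation.Binary.PropositionalEquality
  using (_≡_; _≢_; refl; sym; trans; cong; subst)

quadrate : List ℕ → List ℕ
quadrate []       = []
quadrate (m ∷ μ) = m * 2 ∷ m * 2 ∷ quadrate μ

head-bounds : ∀ {m μ} → Linked _≥_ (m ∷ μ) → All (_≤ m) (m ∷ μ)
head-bounds = Linked⇒All (λ p q → ≤-trans q p) ≤-refl

count-here : ∀ x xs → count x (x ∷ xs) ≡ suc (count x xs)
count-here x xs = cong length (filter-accept (x ≟_) {x} {xs} refl)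

count-there : ∀ {x y} xs → x ≢ y → count x (y ∷ xs) ≡ count x xs
count-there {x} {y} xs x≢y = cong length (filter-reject (x ≟_) {y} {xs} x≢y)

count-unique : ∀ {x xs} → All (x ≢_) xs → count x (x ∷ xs) ≡ 1
count-unique {x} {xs} x∉xs = trans (count-here x xs) (cong (suc ∘ length) (filter-none (x ≟_) x∉xs))

¬even-1 : ¬ Even 1
¬even-1 2∣1 with ∣1⇒≡1 2∣1
... | ()

quadrated-drop-pair : ∀ {a xs} → Quadrated (a ∷ a ∷ xs) → Quadrated xs
quadrated-drop-pair {a} {xs} (_ ∷ _ ∷ even-parts , even-counts) = even-parts , even-count
  where
  even-count : ∀ x → Even (count x xs)
  even-count x with x ≟ a
  ... | yes refl = ∣m+n∣m⇒∣n (subst Even (trans (count-here x (x ∷ xs)) (cong suc (count-here x xs)))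
                                           (even-counts x))
                              ∣-refl
  ... | no x≢a   = subst Even (trans (count-there (a ∷ xs) x≢a) (count-there xs x≢a)) (even-counts x)

-- If a ≠ b then every part after a is below a, so a occurs exactly once.
head-repeated : ∀ {a b xs} → Linked _≥_ (a ∷ b ∷ xs) → Even (count a (a ∷ b ∷ xs)) → a ≡ b
head-repeated {a} {b} {xs} (a≥b ∷ lk) even with a ≟ b
... | yes a≡b = a≡b
... | no a≢b  = ⊥-elim (¬even-1 (subst Even (count-unique smaller) even))
  where
  smaller : All (a ≢_) (b ∷ xs)
  smaller = All.map {Q = a ≢_} (λ y≤b a≡y → <-irrefl (sym a≡y) (≤-<-trans y≤b b<a)) (head-bounds lk)
    where
    b<a : b < a
    b<a = ≤∧≢⇒< a≥b (a≢b ∘ sym)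

quadrated⇒quadrate : ∀ λs → Linked _≥_ λs → Quadrated λs → ∃ λ μ → λs ≡ quadrate μ
quadrated⇒quadrate []            _  _                         = [] , refl
quadrated⇒quadrate (a ∷ [])      _  (_ , even-counts)         =
  ⊥-elim (¬even-1 (subst Even (count-unique {a} []) (even-counts a)))
quadrated⇒quadrate (a ∷ b ∷ xs) lk q@(even-parts , even-counts) with head-repeated lk (even-counts a)
... | refl
  with even-parts
     | quadrated⇒quadrate xs (Linked.tail {R = _≥_} (Linked.tail lk)) (quadrated-drop-pair q)
...   | divides m refl ∷ _ | μ , refl = m ∷ μ , refl

quadrate-isPartition⁻ : ∀ μ → IsPartition (quadrate μ) → IsPartition μ
quadrate-isPartition⁻ μ (pos , lk) = positive μ pos , decreasing μ lk
  where
  positive : ∀ μ → All (0 <_) (quadrate μ) → All (0 <_) μ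
  positive []            _              = []
  positive (suc _ ∷ μ)  (_ ∷ _ ∷ pos)  = s≤s z≤n ∷ positive μ pos

  decreasing : ∀ μ → Linked _≥_ (quadrate μ) → Linked _≥_ μ
  decreasing []             _               = []
  decreasing (_ ∷ [])       _               = [-]
  decreasing (m ∷ n ∷ μ)   (_ ∷ m≥n ∷ lk)  = *-cancelʳ-≤ n m 2 m≥n ∷ decreasing (n ∷ μ) lk

Lm-Lm-quadrate : ∀ μ → Lm (Lm (quadrate μ)) ≡ quadrate (Lm μ)
Lm-Lm-quadrate []                = refl
Lm-Lm-quadrate (zero ∷ μ)        = Lm-Lm-quadrate μ
Lm-Lm-quadrate (suc zero ∷ μ)    = Lm-Lm-quadrate μ
Lm-Lm-quadrate (suc (suc m) ∷ μ) =
  cong (λ ν → suc m * 2 ∷ suc m * 2 ∷ ν) (Lm-Lm-quadrate μ)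

Lm-positive : ∀ xs → All (0 <_) (Lm xs)
Lm-positive []                 = []
Lm-positive (zero ∷ xs)        = Lm-positive xs
Lm-positive (suc zero ∷ xs)    = Lm-positive xs
Lm-positive (suc (suc n) ∷ xs) = s≤s z≤n ∷ Lm-positive xs

Lm-bounded : ∀ {n xs} → All (_< suc n) xs → All (_< n) (Lm xs)
Lm-bounded {xs = []}               []           = []
Lm-bounded {xs = zero ∷ xs}        (_ ∷ xs<)    = Lm-bounded xs<
Lm-bounded {xs = suc zero ∷ xs}    (_ ∷ xs<)    = Lm-bounded xs<
Lm-bounded {xs = suc (suc _) ∷ xs} (x< ∷ xs<) = ≤-pred x< ∷ Lm-bounded xs<

bounded : ∀ xs → ∃ λ n → All (_< n) xs
bounded []       = 0 , []
bounded (x ∷ xs) with bounded xs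
... | n , xs<n = suc x + n , s≤s (m≤m+n x n) ∷ All.map (λ y<n → ≤-trans y<n (m≤n+m n (suc x))) xs<n

-- The L move lowers the strict bound on the parts, the T move shortens the
-- list: a double induction.
quadrate-isP : ∀ μ → All (0 <_) μ → IsP (quadrate μ)
quadrate-isP μ pos = go μ pos (proj₂ (bounded μ))
  where
  go : ∀ {n} μ → All (0 <_) μ → All (_< n) μ → IsP (quadrate μ)
  go []                   _          _                    = P-empty
  go {zero}  (_ ∷ _)      _          (() ∷ _)
  go {suc n} (suc m ∷ μ)  (_ ∷ pos)  bound@(_ ∷ μ<)      =
    P-cons (N-L (subst IsP (sym (Lm-Lm-quadrate (suc m ∷ μ)))
                  (go (Lm (suc m ∷ μ)) (Lm-positive (suc m ∷ μ)) (Lm-bounded bound))))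
           (N-T (go μ pos μ<))

LT≡TL-quadrate : ∀ {m μ} → 0 < m → Lm (Tm (quadrate (m ∷ μ))) ≡ Tm (Lm (quadrate (m ∷ μ)))
LT≡TL-quadrate {suc _} _ = refl

Lm-quadrate-ones : ∀ {μ} → All (_≤ 1) μ → IsOnes (Lm (quadrate μ))
Lm-quadrate-ones []                       = 0 , refl
Lm-quadrate-ones {zero ∷ _}      (_ ∷ μ≤) = Lm-quadrate-ones μ≤
Lm-quadrate-ones {suc zero ∷ _}  (_ ∷ μ≤) with Lm-quadrate-ones μ≤
... | n , eq = suc (suc n) , cong (λ ν → 1 ∷ 1 ∷ ν) eq
Lm-quadrate-ones {suc (suc _) ∷ _} (s≤s () ∷ _)

LT-quadrate-isP : ∀ {m μ} → IsPartition (m ∷ μ) →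
  ¬ IsSingle (Lm (Tm (quadrate (m ∷ μ)))) → ¬ IsOnes (Lm (Tm (quadrate (m ∷ μ)))) →
  IsP (Lm (Tm (quadrate (m ∷ μ))))
LT-quadrate-isP {zero} (() ∷ _ , _) _ _
LT-quadrate-isP {suc _} {[]} _ ¬single _ = ⊥-elim (¬single (_ , refl))
LT-quadrate-isP {suc zero} {μ} (_ , lk) _ ¬ones with Lm-quadrate-ones (All.tail (head-bounds lk))
... | n , eq = ⊥-elim (¬ones (suc n , cong (1 ∷_) eq))
LT-quadrate-isP {suc (suc _)} {suc k ∷ μ} (_ ∷ pos , _) _ _ = P-cons (N-T LLμ-isP) (N-L LLμ-isP)
  where
  LLμ-isP : IsP (Lm (Lm (quadrate (suc k ∷ μ))))
  LLμ-isP = subst IsP (sym (Lm-Lm-quadrate (suc k ∷ μ)))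
              (quadrate-isP (Lm (suc k ∷ μ)) (Lm-positive (suc k ∷ μ)))
LT-quadrate-isP {suc (suc _)} {zero ∷ _} (_ ∷ () ∷ _ , _) _ _

SG-total : ∀ xs → ∃ (SG xs)
SG-total xs = go xs (proj₂ (bounded xs))
  where
  go : ∀ {n} xs → All (_< n) xs → ∃ (SG xs)
  go []                   _                  = 0 , SG-empty
  go {zero}  (_ ∷ _)      (() ∷ _)
  go {suc n} (x ∷ xs)     bound@(_ ∷ xs<)
    with go (Lm (x ∷ xs)) (Lm-bounded bound) | go xs xs<
  ... | a , SG-L | b , SG-T = mex2 a b , SG-cons SG-L SG-T

mex2≡0 : ∀ {a b} → a ≢ 0 → b ≢ 0 → mex2 a b ≡ 0
mex2≡0 {zero}          a≢0 _   = ⊥-elim (a≢0 refl)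
mex2≡0 {suc _} {zero}  _   b≢0 = ⊥-elim (b≢0 refl)
mex2≡0 {suc _} {suc _} _   _   = refl

mex2-0ˡ≢0 : ∀ b → mex2 0 b ≢ 0
mex2-0ˡ≢0 zero           ()
mex2-0ˡ≢0 (suc zero)     ()
mex2-0ˡ≢0 (suc (suc _))  ()

mex2-0ʳ≢0 : ∀ a → mex2 a 0 ≢ 0
mex2-0ʳ≢0 zero           ()
mex2-0ʳ≢0 (suc zero)     ()
mex2-0ʳ≢0 (suc (suc _))  ()

isP⇒SG≡0 : ∀ {xs g} → IsP xs → SG xs g → g ≡ 0
isN⇒SG≢0 : ∀ {xs g} → IsN xs → SG xs g → g ≢ 0
isP⇒SG≡0 P-empty         SG-empty          = refl
isP⇒SG≡0 (P-cons NL NT)  (SG-cons SGL SGT) = mex2≡0 (isN⇒SG≢0 NL SGL) (isN⇒SG≢0 NT SGT)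
isN⇒SG≢0 (N-L PL) (SG-cons {b = b} SGL _) with isP⇒SG≡0 PL SGL
... | refl = mex2-0ˡ≢0 b
isN⇒SG≢0 (N-T PT) (SG-cons {a = a} _ SGT) with isP⇒SG≡0 PT SGT
... | refl = mex2-0ʳ≢0 a

isP⇒SG0 : ∀ {xs} → IsP xs → SG xs 0
isP⇒SG0 {xs} P with SG-total xs
... | g , SGg = subst (SG xs) (isP⇒SG≡0 P SGg) SGg

lemma3p8 : (lam : List ℕ) → IsPartition lam → Quadrated lam →
    (IsP lam × SG lam 0) ×
    (lam ≢ [] →
      (Lm (Tm lam) ≡ Tm (Lm lam)) ×
      (¬ IsSingle (Lm (Tm lam)) → ¬ IsOnes (Lm (Tm lam)) →
        IsP (Lm (Tm lam)) × SG (Lm (Tm lam)) 0))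
lemma3p8 lam part@(_ , lk) q with quadrated⇒quadrate lam lk q
... | [] , refl = (P-empty , SG-empty) , λ nonempty → ⊥-elim (nonempty refl)
... | m ∷ μ , refl =
  (isP , isP⇒SG0 isP) ,
  λ _ → LT≡TL-quadrate m>0 ,
        λ ¬single ¬ones → let LT-isP = LT-quadrate-isP μ-part ¬single ¬ones in LT-isP , isP⇒SG0 LT-isP
  where
  μ-part : IsPartition (m ∷ μ)
  μ-part = quadrate-isPartition⁻ (m ∷ μ) part

  m>0 : 0 < m
  m>0 = All.head (proj₁ μ-part)

  isP : IsP (quadrate (m ∷ μ))
  isP = quadrate-isP (m ∷ μ) (proj₁ μ-part)
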